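{- Let $p$ be a prime number and let $T_{2p}\langle 2,p\rangle$ be the Toeplitz graph on $\{1,\dots,2p\}$ with generating set $\{2,p\}$. Then $$\frac{2p}{2p-1}\leq \mathrm{ldim}_{\mathrm{f}}(T_{2p}\langle 2,p\rangle)\leq \frac{2p}{2p-2}=\frac{p}{p-1}.$$
   Context: For a positive integer $n$ and $S\subseteq\{1,\dots,n\}$, the Toeplitz graph $T_n\langle S\rangle$ has vertex set $\{1,2,\dots,n\}$, and distinct vertices $p,q$ are adjacent iff $|p-q|\in S$. For a finite simple graph $G$ with shortest-path distance $d$ (taken to be $\infty$ between different components), and vertices $v,w$, the resolving neighborhood is $\mathcal{R}\{v,w\}=\{u\in V(G): d(u,v)\neq d(u,w)\}$. A local resolving function of $G$ is a map $\zeta:V(G)\to[0,1]$ such that $\sum_{u\in\mathcal{R}\{v,w\}}\zeta(u)\geq 1$ for every edge $vw$ of $G$. The local fractional metric dimension is $\mathrm{ldim}_{\mathrm{f}}(G)=\min\{\sum_{v\in V(G)}\zeta(v): \zeta \text{ a local resolving function of } G\}$.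
   Formalization: The local resolving functions ζ take only rational values in $[0,1]$. -}

module Defs where

open import Data.Nat using (ℕ; zero; suc; _≡ᵇ_; ∣_-_∣)
open import Data.Bool using (Bool; true; false; not; _∧_; _∨_; if_then_else_)
open import Data.Fin using (Fin; toℕ) renaming (zero to fz; suc to fs)
open import Data.Maybe using (Maybe; just; nothing)
open import Data.List using (List)
open import Data.Bool.ListAction using (any)
open import Data.Product using (_×_)
open import Relation.Binary.PropositionalEquality using (_≡_)
open import Data.Rational.Unnormalised using (ℚᵘ; 0ℚᵘ; 1ℚᵘ; _+_; _≤_)

-- Vertex i : Fin n represents the vertex (toℕ i + 1) of {1,…,n};
-- differences |p - q| are unchanged by this shift.

adj : {n : ℕ} → List ℕ → Fin n → Fin n → Bool
adj S i j = not (toℕ i ≡ᵇ toℕ j) ∧ any (λ s → ∣ toℕ i - toℕ j ∣ ≡ᵇ s) S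

anyFin : {n : ℕ} → (Fin n → Bool) → Bool
anyFin {zero} f = false
anyFin {suc n} f = f fz ∨ anyFin (λ i → f (fs i))

ball : {n : ℕ} → List ℕ → ℕ → Fin n → Fin n → Bool
ball S zero u v = toℕ u ≡ᵇ toℕ v
ball S (suc k) u v = ball S k u v ∨ anyFin (λ w → ball S k u w ∧ adj S w v)

search : {n : ℕ} → List ℕ → ℕ → ℕ → Fin n → Fin n → Maybe ℕ
search S k₀ zero u v = nothing
search S k₀ (suc fuel) u v =
  if ball S k₀ u v then just k₀ else search S (suc k₀) fuel u v

-- Shortest-path distance: just d, or nothing (= ∞) for different components.
-- Any reachable vertex is at distance < n, so searching k = 0,…,n-1 suffices.
dist : {n : ℕ} → List ℕ → Fin n → Fin n → Maybe ℕ
dist {n} S u v = search S 0 n u v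

eqDist : Maybe ℕ → Maybe ℕ → Bool
eqDist nothing nothing = true
eqDist (just a) (just b) = a ≡ᵇ b
eqDist _ _ = false

inR : {n : ℕ} → List ℕ → Fin n → Fin n → Fin n → Bool
inR S v w u = not (eqDist (dist S u v) (dist S u w))

sumFin : {n : ℕ} → (Fin n → ℚᵘ) → ℚᵘ
sumFin {zero} f = 0ℚᵘ
sumFin {suc n} f = f fz + sumFin (λ i → f (fs i))

sumR : {n : ℕ} → List ℕ → (Fin n → ℚᵘ) → Fin n → Fin n → ℚᵘ
sumR S ζ v w = sumFin (λ u → if inR S v w u then ζ u else 0ℚᵘ)

LocalResolving : (n : ℕ) → List ℕ → (Fin n → ℚᵘ) → Set
LocalResolving n S ζ =
  ((u : Fin n) → (0ℚᵘ ≤ ζ u) × (ζ u ≤ 1ℚᵘ)) ×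
  ((v w : Fin n) → adj S v w ≡ true → 1ℚᵘ ≤ sumR S ζ v w)

-- For odd p = 2m + 1 the distance between two vertices of T_{2p}⟨2,p⟩ depends
-- only on the difference of their labels, through an explicit formula D; it is
-- identified with dist because it vanishes only on the diagonal,
-- changes by at most one along an edge, and always drops along some edge.
-- From the formula, every vertex u is equidistant from the ends of some edge,
-- so 1 + ζ(u) ≤ Σ ζ, and summing over u gives Σ ζ ≥ 2p/(2p-1); and every edge
-- is equidistant from at most two vertices, so the constant 1/(2p-2) is a local
-- resolving function.  For p = 2 the graph is two disjoint edges.
module Submission where

module BoolReflection where

  open import Defs
  open import Data.Nat using (suc; _≡ᵇ_)
  open import Data.Nat.Properties using (≡ᵇ⇒≡; ≡⇒≡ᵇ)
  open import Data.Bool using (Bool; true; false; _∧_; _∨_; T)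
  open import Data.Fin using (Fin) renaming (zero to fz; suc to fs)
  open import Data.Product using (_×_; _,_; ∃)
  open import Data.Sum using (_⊎_; inj₁; inj₂)
  open import Relation.Binary.PropositionalEquality using (_≡_; refl; sym; subst)
  open import Relation.Nullary using (¬_; contradiction)

  ∨-true : ∀ a b → a ∨ b ≡ true → a ≡ true ⊎ b ≡ true
  ∨-true true  b _ = inj₁ refl
  ∨-true false b e = inj₂ e

  ∧-true : ∀ a b → a ∧ b ≡ true → a ≡ true × b ≡ true
  ∧-true true true _ = refl , refl

  anyFin-true : ∀ {n} (f : Fin n → Bool) → anyFin f ≡ true → ∃ λ i → f i ≡ true
  anyFin-true {suc n} f e with ∨-true (f fz) _ e
  ... | inj₁ f0 = fz , f0
  ... | inj₂ rest with anyFin-true (λ i → f (fs i)) rest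
  ...   | i , fi = fs i , fi

  anyFin-intro : ∀ {n} (f : Fin n → Bool) i → f i ≡ true → anyFin f ≡ true
  anyFin-intro f fz e rewrite e = refl
  anyFin-intro f (fs i) e rewrite anyFin-intro (λ j → f (fs j)) i e with f fz
  ... | true  = refl
  ... | false = refl

  ≡ᵇ-true⇒≡ : ∀ a b → (a ≡ᵇ b) ≡ true → a ≡ b
  ≡ᵇ-true⇒≡ a b e = ≡ᵇ⇒≡ a b (subst T (sym e) _)

  ≡⇒≡ᵇ-true : ∀ a b → a ≡ b → (a ≡ᵇ b) ≡ true
  ≡⇒≡ᵇ-true a b e with a ≡ᵇ b | ≡⇒≡ᵇ a b e
  ... | true | _ = refl

  ≢⇒≡ᵇ-false : ∀ a b → ¬ a ≡ b → (a ≡ᵇ b) ≡ false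
  ≢⇒≡ᵇ-false a b a≢b with a ≡ᵇ b in eq
  ... | false = refl
  ... | true  = contradiction (≡ᵇ-true⇒≡ a b eq) a≢b


module ShortestPath where

  open import Defs
  open import Data.Nat using (ℕ; zero; suc; _≤_; _<_; z≤n; s≤s; _+_)
  open import Data.Nat.Properties
  open import Data.Bool using (true; false; _∧_)
  open import Data.Fin using (Fin; toℕ)
  open import Data.List using (List)
  open import Data.Maybe using (just)
  open import Data.Product using (_×_; _,_; ∃)
  open import Data.Sum using (inj₁; inj₂)
  open import Relation.Binary.PropositionalEquality using (_≡_; refl; sym; cong₂; subst)
  open import Relation.Nullary using (contradiction)
  open BoolReflection

  module Characterisation
    (n : ℕ) (S : List ℕ) (G : Fin n → Fin n → ℕ)
    (G≡0⇒≡ : ∀ u v → G u v ≡ 0 → toℕ u ≡ toℕ v)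
    (≡⇒G≡0 : ∀ u v → toℕ u ≡ toℕ v → G u v ≡ 0)
    (G-adj : ∀ u w v → adj S w v ≡ true → G u v ≤ suc (G u w))
    (G-pred : ∀ u v k → G u v ≡ suc k → ∃ λ w → adj S w v ≡ true × G u w ≡ k)
    (G<n : ∀ u v → G u v < n)
    where

    ball⇒G≤ : ∀ k u v → ball S k u v ≡ true → G u v ≤ k
    ball⇒G≤ zero u v e = ≤-reflexive (≡⇒G≡0 u v (≡ᵇ-true⇒≡ _ _ e))
    ball⇒G≤ (suc k) u v e with ∨-true (ball S k u v) _ e
    ... | inj₁ inner = m≤n⇒m≤1+n (ball⇒G≤ k u v inner)
    ... | inj₂ step with anyFin-true _ step
    ...   | w , bw with ∧-true (ball S k u w) _ bw
    ...     | uw , wv = ≤-trans (G-adj u w v wv) (s≤s (ball⇒G≤ k u w uw))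

    G≤⇒ball : ∀ k u v → G u v ≤ k → ball S k u v ≡ true
    G≤⇒ball zero u v le = ≡⇒≡ᵇ-true _ _ (G≡0⇒≡ u v (n≤0⇒n≡0 le))
    G≤⇒ball (suc k) u v le with m≤n⇒m<n∨m≡n le
    ... | inj₁ (s≤s lt) rewrite G≤⇒ball k u v lt = refl
    ... | inj₂ eq with G-pred u v k eq
    ...   | w , wv , uw with ball S k u v
    ...     | true  = refl
    ...     | false = anyFin-intro _ w (cong₂ _∧_ (G≤⇒ball k u w (≤-reflexive uw)) wv)

    search≡G : ∀ fuel k₀ u v → k₀ ≤ G u v → G u v < k₀ + fuel →
               search S k₀ fuel u v ≡ just (G u v)
    search≡G zero k₀ u v le lt = contradiction le (<⇒≱ (subst (G u v <_) (+-identityʳ k₀) lt))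
    search≡G (suc fuel) k₀ u v le lt with m≤n⇒m<n∨m≡n le
    ... | inj₂ eq rewrite sym eq | G≤⇒ball k₀ u v (≤-reflexive (sym eq)) = refl
    ... | inj₁ lt′ with ball S k₀ u v in b
    ...   | true  = contradiction (ball⇒G≤ k₀ u v b) (<⇒≱ lt′)
    ...   | false = search≡G fuel (suc k₀) u v lt′ (subst (G u v <_) (+-suc k₀ fuel) lt)

    dist≡G : ∀ u v → dist S u v ≡ just (G u v)
    dist≡G u v = search≡G n 0 u v z≤n (G<n u v)


module Fractional where

  open import Defs
  open import Data.Nat as ℕ using (ℕ; zero; suc; z≤n; s≤s)
  import Data.Nat.Properties as ℕP
  open import Data.Nat.Tactic.RingSolver using (solve-∀)
  open import Data.Integer as ℤ using (+_; +≤+)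
  import Data.Integer.Properties as ℤP
  open import Data.Bool using (Bool; true; false; not; if_then_else_)
  open import Data.Fin using (Fin; toℕ) renaming (zero to fz; suc to fs)
  open import Data.Product using (Σ; _×_; _,_; proj₁)
  open import Data.Sum using (_⊎_; inj₁; inj₂)
  open import Relation.Binary.PropositionalEquality using (_≡_; refl; sym; trans; cong; cong₂; subst₂)
  open import Relation.Nullary using (yes; no; contradiction)
  open import Data.Rational.Unnormalised using (ℚᵘ; mkℚᵘ; 0ℚᵘ; 1ℚᵘ; _+_; -_; _≤_; _<_; _≃_; *≤*; *≡*)
  open import Data.Rational.Unnormalised.Properties
  open import Algebra.Bundles using (CommutativeMonoid)
  import Algebra.Properties.CommutativeSemigroup as CommutativeSemigroupProperties
  open BoolReflection using (≡⇒≡ᵇ-true)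

  ℕ-interchange : ∀ a b c d → (a ℕ.+ b) ℕ.+ (c ℕ.+ d) ≡ (a ℕ.+ c) ℕ.+ (b ℕ.+ d)
  ℕ-interchange = CommutativeSemigroupProperties.interchange ℕP.+-commutativeSemigroup

  ℚᵘ-interchange : ∀ a b c d → (a + b) + (c + d) ≃ (a + c) + (b + d)
  ℚᵘ-interchange = CommutativeSemigroupProperties.interchange
    (CommutativeMonoid.commutativeSemigroup +-0-commutativeMonoid)

  mkℚᵘ-mono-≤ : ∀ a b c d → a ℕ.* suc d ℕ.≤ c ℕ.* suc b → mkℚᵘ (+ a) b ≤ mkℚᵘ (+ c) d
  mkℚᵘ-mono-≤ a b c d h = *≤* (subst₂ ℤ._≤_ (ℤP.pos-* a (suc d)) (ℤP.pos-* c (suc b)) (+≤+ h))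

  mkℚᵘ-cong : ∀ a b c d → a ℕ.* suc d ≡ c ℕ.* suc b → mkℚᵘ (+ a) b ≃ mkℚᵘ (+ c) d
  mkℚᵘ-cong a b c d h = *≡* (trans (sym (ℤP.pos-* a (suc d))) (trans (cong +_ h) (ℤP.pos-* c (suc b))))

  mkℚᵘ-+ : ∀ a b k → mkℚᵘ (+ a) k + mkℚᵘ (+ b) k ≃ mkℚᵘ (+ (a ℕ.+ b)) k
  mkℚᵘ-+ a b k = *≡* (begin
      (+ a ℤ.* + suc k ℤ.+ + b ℤ.* + suc k) ℤ.* + suc k
        ≡⟨ cong (ℤ._* + suc k) (cong₂ ℤ._+_ (sym (ℤP.pos-* a (suc k))) (sym (ℤP.pos-* b (suc k)))) ⟩
      + (a ℕ.* suc k ℕ.+ b ℕ.* suc k) ℤ.* + suc k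
        ≡⟨ sym (ℤP.pos-* (a ℕ.* suc k ℕ.+ b ℕ.* suc k) (suc k)) ⟩
      + ((a ℕ.* suc k ℕ.+ b ℕ.* suc k) ℕ.* suc k)
        ≡⟨ cong +_ (rearrange a b k) ⟩
      + ((a ℕ.+ b) ℕ.* (suc k ℕ.* suc k))
        ≡⟨ ℤP.pos-* (a ℕ.+ b) (suc k ℕ.* suc k) ⟩
      + (a ℕ.+ b) ℤ.* + (suc k ℕ.* suc k) ∎)
    where
    open Relation.Binary.PropositionalEquality.≡-Reasoning
    rearrange : ∀ a b k → (a ℕ.* suc k ℕ.+ b ℕ.* suc k) ℕ.* suc k ≡ (a ℕ.+ b) ℕ.* (suc k ℕ.* suc k)
    rearrange = solve-∀

  infixr 7 _·_

  _·_ : ℕ → ℚᵘ → ℚᵘ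
  zero  · c = 0ℚᵘ
  suc j · c = c + j · c

  ·-mkℚᵘ : ∀ j a k → j · mkℚᵘ (+ a) k ≃ mkℚᵘ (+ (j ℕ.* a)) k
  ·-mkℚᵘ zero    a k = *≡* refl
  ·-mkℚᵘ (suc j) a k = ≃-trans (+-congʳ (mkℚᵘ (+ a) k) (·-mkℚᵘ j a k)) (mkℚᵘ-+ a (j ℕ.* a) k)

  ·-nonNeg : ∀ j {c} → 0ℚᵘ ≤ c → 0ℚᵘ ≤ j · c
  ·-nonNeg zero    _  = ≤-refl
  ·-nonNeg (suc j) c≥0 = ≤-respˡ-≃ (+-identityˡ 0ℚᵘ) (+-mono-≤ c≥0 (·-nonNeg j c≥0))

  ·-monoˡ-≤ : ∀ {c} → 0ℚᵘ ≤ c → ∀ {i j} → i ℕ.≤ j → i · c ≤ j · c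
  ·-monoˡ-≤ c≥0 {j = j} z≤n       = ·-nonNeg j c≥0
  ·-monoˡ-≤ {c} c≥0 (s≤s i≤j) = +-monoʳ-≤ c (·-monoˡ-≤ c≥0 i≤j)

  ·-monoʳ-≤ : ∀ j {c d} → c ≤ d → j · c ≤ j · d
  ·-monoʳ-≤ zero    _   = ≤-refl
  ·-monoʳ-≤ (suc j) c≤d = +-mono-≤ c≤d (·-monoʳ-≤ j c≤d)

  ·-monoʳ-< : ∀ j {c d} → c < d → suc j · c < suc j · d
  ·-monoʳ-< j c<d = +-mono-<-≤ c<d (·-monoʳ-≤ j (<⇒≤ c<d))

  sumFin-const : ∀ n c → sumFin {n} (λ _ → c) ≡ n · c
  sumFin-const zero    c = refl
  sumFin-const (suc n) c = cong (λ s → c + s) (sumFin-const n c)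

  sumFin-mono : ∀ {n} {f g : Fin n → ℚᵘ} → (∀ i → f i ≤ g i) → sumFin f ≤ sumFin g
  sumFin-mono {zero}  _   = ≤-refl
  sumFin-mono {suc n} f≤g = +-mono-≤ (f≤g fz) (sumFin-mono (λ i → f≤g (fs i)))

  sumFin-+ : ∀ {n} (f g : Fin n → ℚᵘ) → sumFin (λ i → f i + g i) ≃ sumFin f + sumFin g
  sumFin-+ {zero}  f g = ≃-sym (+-identityˡ 0ℚᵘ)
  sumFin-+ {suc n} f g =
    ≃-trans (+-congʳ (f fz + g fz) (sumFin-+ (λ i → f (fs i)) (λ i → g (fs i))))
            (ℚᵘ-interchange (f fz) (g fz) _ _)

  sumFin-+-vanishing : ∀ {n} (h ζ : Fin n → ℚᵘ) u → (∀ i → h i ≤ ζ i) → h u ≃ 0ℚᵘ →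
                       sumFin h + ζ u ≤ sumFin ζ
  sumFin-+-vanishing {suc n} h ζ fz h≤ζ hu≃0 =
    ≤-respˡ-≃ (≃-sym rest+ζ₀) (+-monoʳ-≤ (ζ fz) (sumFin-mono (λ i → h≤ζ (fs i))))
    where
    rest = sumFin (λ i → h (fs i))
    rest+ζ₀ : (h fz + rest) + ζ fz ≃ ζ fz + rest
    rest+ζ₀ = ≃-trans (+-comm (h fz + rest) (ζ fz))
                      (+-congʳ (ζ fz) (≃-trans (+-congˡ rest hu≃0) (+-identityˡ rest)))
  sumFin-+-vanishing {suc n} h ζ (fs u) h≤ζ hu≃0 =
    ≤-respˡ-≃ (≃-sym (+-assoc (h fz) _ (ζ (fs u))))
      (+-mono-≤ (h≤ζ fz) (sumFin-+-vanishing (λ i → h (fs i)) (λ i → ζ (fs i)) u (λ i → h≤ζ (fs i)) hu≃0))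

  +-cancelʳ-≤′ : ∀ a b c → a + c ≤ c + b → a ≤ b
  +-cancelʳ-≤′ a b c h =
    ≤-respʳ-≃ (+c-c b) (≤-respˡ-≃ (+c-c a) (+-monoˡ-≤ (- c) (≤-respʳ-≃ (+-comm c b) h)))
    where
    +c-c : ∀ x → (x + c) + - c ≃ x
    +c-c x = ≃-trans (+-assoc x c (- c)) (≃-trans (+-congʳ x (+-inverseʳ c)) (+-identityʳ x))

  -- A vertex u outside R{v,w} for an edge vw gives 1 + ζ u ≤ Σ ζ; summed over
  -- all n vertices, n + Σ ζ ≤ n · Σ ζ.
  ldim-lower-bound : ∀ n S (ζ : Fin n → ℚᵘ) → 2 ℕ.≤ n → LocalResolving n S ζ →
    (∀ u → Σ (Fin n) λ v → Σ (Fin n) λ w → adj S v w ≡ true × inR S v w u ≡ false) →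
    mkℚᵘ (+ n) (n ℕ.∸ 2) ≤ sumFin ζ
  ldim-lower-bound .(suc (suc k)) S ζ (s≤s (s≤s {n = k} z≤n)) (ζ∈[0,1] , resolving) unresolved
    with mkℚᵘ (+ suc (suc k)) k ≤? sumFin ζ
  ... | yes bound = bound
  ... | no ¬bound = contradiction
        (≤-<-trans n≤[n-1]T (<-≤-trans (·-monoʳ-< k (≰⇒> ¬bound)) (≤-reflexive [n-1]c≃n)))
        (<-irrefl ≃-refl)
    where
    n = suc (suc k)
    T = sumFin ζ
    1+ζ≤T : ∀ u → 1ℚᵘ + ζ u ≤ T
    1+ζ≤T u with unresolved u
    ... | v , w , vw , u∉R =
      ≤-trans (+-monoˡ-≤ (ζ u) (resolving v w vw)) (sumFin-+-vanishing h ζ u h≤ζ hu≃0)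
      where
      h : Fin n → ℚᵘ
      h i = if inR S v w i then ζ i else 0ℚᵘ
      h≤ζ : ∀ i → h i ≤ ζ i
      h≤ζ i with inR S v w i
      ... | true  = ≤-refl
      ... | false = proj₁ (ζ∈[0,1] i)
      hu≃0 : h u ≃ 0ℚᵘ
      hu≃0 rewrite u∉R = ≃-refl
    n·1+T≤T+[n-1]T : n · 1ℚᵘ + T ≤ T + suc k · T
    n·1+T≤T+[n-1]T =
      ≤-respˡ-≃ (≃-trans (sumFin-+ (λ _ → 1ℚᵘ) ζ) (≃-reflexive (cong (_+ T) (sumFin-const n 1ℚᵘ))))
        (≤-trans (sumFin-mono 1+ζ≤T) (≤-reflexive (≃-reflexive (sumFin-const n T))))
    n·1≃n : n · 1ℚᵘ ≃ mkℚᵘ (+ n) 0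
    n·1≃n = ≃-trans (·-mkℚᵘ n 1 0) (mkℚᵘ-cong _ 0 n 0 (ℕP.*-identityʳ (n ℕ.* 1)))
    n≤[n-1]T : mkℚᵘ (+ n) 0 ≤ suc k · T
    n≤[n-1]T = ≤-respˡ-≃ n·1≃n (+-cancelʳ-≤′ _ _ T n·1+T≤T+[n-1]T)
    [n-1]c≃n : suc k · mkℚᵘ (+ n) k ≃ mkℚᵘ (+ n) 0
    [n-1]c≃n = ≃-trans (·-mkℚᵘ (suc k) n k) (mkℚᵘ-cong _ k n 0 (rearrange k))
      where
      rearrange : ∀ k → suc k ℕ.* suc (suc k) ℕ.* 1 ≡ suc (suc k) ℕ.* suc k
      rearrange = solve-∀

  bit : Bool → ℕ
  bit true  = 1
  bit false = 0

  count : ∀ {n} → (Fin n → Bool) → ℕ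
  count {zero}  b = 0
  count {suc n} b = bit (b fz) ℕ.+ count (λ i → b (fs i))

  count-false : ∀ n → count {n} (λ _ → false) ≡ 0
  count-false zero    = refl
  count-false (suc n) = count-false n

  count+count-not : ∀ {n} (b : Fin n → Bool) → count b ℕ.+ count (λ u → not (b u)) ≡ n
  count+count-not {zero}  b = refl
  count+count-not {suc n} b =
    trans (ℕ-interchange (bit (b fz)) _ _ _)
          (cong₂ ℕ._+_ (bit+bit-not (b fz)) (count+count-not (λ i → b (fs i))))
    where
    bit+bit-not : ∀ x → bit x ℕ.+ bit (not x) ≡ 1
    bit+bit-not true  = refl
    bit+bit-not false = refl

  count-≤-∨ : ∀ {n} (b b₁ b₂ : Fin n → Bool) → (∀ u → b u ≡ true → b₁ u ≡ true ⊎ b₂ u ≡ true) →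
              count b ℕ.≤ count b₁ ℕ.+ count b₂
  count-≤-∨ {zero}  b b₁ b₂ _ = z≤n
  count-≤-∨ {suc n} b b₁ b₂ b⊆ =
    ℕP.≤-trans (ℕP.+-mono-≤ (bit-≤-∨ (b fz) (b₁ fz) (b₂ fz) (b⊆ fz))
                            (count-≤-∨ (λ i → b (fs i)) (λ i → b₁ (fs i)) (λ i → b₂ (fs i)) (λ i → b⊆ (fs i))))
               (ℕP.≤-reflexive (ℕ-interchange (bit (b₁ fz)) (bit (b₂ fz)) _ _))
    where
    bit-≤-∨ : ∀ x y z → (x ≡ true → y ≡ true ⊎ z ≡ true) → bit x ℕ.≤ bit y ℕ.+ bit z
    bit-≤-∨ false y z _ = z≤n
    bit-≤-∨ true  y z x⊆ with x⊆ refl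
    ... | inj₁ refl = s≤s z≤n
    ... | inj₂ refl = ℕP.m≤n+m 1 (bit y)

  count-≡ᵇ : ∀ {n} c → count {n} (λ u → toℕ u ℕ.≡ᵇ c) ℕ.≤ 1
  count-≡ᵇ {zero}  c       = z≤n
  count-≡ᵇ {suc n} zero    = ℕP.≤-reflexive (cong suc (count-false n))
  count-≡ᵇ {suc n} (suc c) = count-≡ᵇ {n} c

  count-cofinite : ∀ {n} (b : Fin n → Bool) c₁ c₂ → (∀ u → b u ≡ false → toℕ u ≡ c₁ ⊎ toℕ u ≡ c₂) →
                   n ℕ.≤ count b ℕ.+ 2
  count-cofinite {n} b c₁ c₂ b⊇ = begin
    n
      ≡⟨ sym (count+count-not b) ⟩
    count b ℕ.+ count (λ u → not (b u))
      ≤⟨ ℕP.+-monoʳ-≤ (count b) (count-≤-∨ _ _ _ not-b⊆) ⟩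
    count b ℕ.+ (count {n} (λ u → toℕ u ℕ.≡ᵇ c₁) ℕ.+ count {n} (λ u → toℕ u ℕ.≡ᵇ c₂))
      ≤⟨ ℕP.+-monoʳ-≤ (count b) (ℕP.+-mono-≤ (count-≡ᵇ {n} c₁) (count-≡ᵇ {n} c₂)) ⟩
    count b ℕ.+ 2
      ∎
    where
    open ℕP.≤-Reasoning
    not-b⊆ : ∀ u → not (b u) ≡ true → (toℕ u ℕ.≡ᵇ c₁) ≡ true ⊎ (toℕ u ℕ.≡ᵇ c₂) ≡ true
    not-b⊆ u nb with b u in bu
    not-b⊆ u () | true
    ... | false with b⊇ u bu
    ...   | inj₁ e = inj₁ (≡⇒≡ᵇ-true _ _ e)
    ...   | inj₂ e = inj₂ (≡⇒≡ᵇ-true _ _ e)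

  sumFin-if : ∀ {n} (b : Fin n → Bool) c → sumFin (λ u → if b u then c else 0ℚᵘ) ≃ count b · c
  sumFin-if {zero}  b c = ≃-refl
  sumFin-if {suc n} b c with b fz
  ... | true  = +-congʳ c (sumFin-if (λ i → b (fs i)) c)
  ... | false = ≃-trans (+-identityˡ _) (sumFin-if (λ i → b (fs i)) c)

  -- The witness is the constant 1/(n-2): every R{v,w} has at least n - 2 vertices.
  ldim-upper-bound : ∀ n S → 3 ℕ.≤ n →
    (∀ (v w : Fin n) → adj S v w ≡ true →
       Σ ℕ λ c₁ → Σ ℕ λ c₂ → ∀ u → inR S v w u ≡ false → toℕ u ≡ c₁ ⊎ toℕ u ≡ c₂) →
    Σ (Fin n → ℚᵘ) (λ ζ → LocalResolving n S ζ × (sumFin ζ ≤ mkℚᵘ (+ n) (n ℕ.∸ 3)))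
  ldim-upper-bound .(suc (suc (suc k))) S (s≤s (s≤s (s≤s {n = k} z≤n))) unresolved =
    (λ _ → c) , ((λ _ → c≥0 , c≤1) , resolving) , total
    where
    n = suc (suc (suc k))
    c = mkℚᵘ (+ 1) k
    c≥0 : 0ℚᵘ ≤ c
    c≥0 = mkℚᵘ-mono-≤ 0 0 1 k z≤n
    c≤1 : c ≤ 1ℚᵘ
    c≤1 = mkℚᵘ-mono-≤ 1 k 1 0 (s≤s z≤n)
    [n-2]c≃1 : suc k · c ≃ 1ℚᵘ
    [n-2]c≃1 = ≃-trans (·-mkℚᵘ (suc k) 1 k) (mkℚᵘ-cong _ k 1 0 (trans (ℕP.*-identityʳ _) (ℕP.*-comm (suc k) 1)))
    resolving : ∀ v w → adj S v w ≡ true → 1ℚᵘ ≤ sumR S (λ _ → c) v w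
    resolving v w vw with unresolved v w vw
    ... | c₁ , c₂ , few =
      ≤-respʳ-≃ (≃-sym (sumFin-if (λ u → inR S v w u) c))
        (≤-respˡ-≃ [n-2]c≃1 (·-monoˡ-≤ c≥0 (ℕP.+-cancelʳ-≤ 2 (suc k) _
          (ℕP.≤-trans (ℕP.≤-reflexive (ℕP.+-comm (suc k) 2)) (count-cofinite _ c₁ c₂ few)))))
    total : sumFin {n} (λ _ → c) ≤ mkℚᵘ (+ n) k
    total = ≤-respˡ-≃ (≃-sym (≃-trans (≃-reflexive (sumFin-const n c)) (·-mkℚᵘ n 1 k)))
              (mkℚᵘ-mono-≤ _ k n k (ℕP.≤-reflexive (cong (ℕ._* suc k) (ℕP.*-identityʳ n))))


module Difference where

  open import Data.Nat
  open import Data.Nat.Properties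
  open import Data.Nat.Tactic.RingSolver using (solve-∀)
  open import Data.Bool using (Bool; true; false)
  open import Data.Product using (_×_; _,_; ∃; map₁)
  open import Data.Sum using (_⊎_; inj₁; inj₂)
  open import Relation.Binary.PropositionalEquality
  open import Relation.Nullary using (yes; no; contradiction)

  Near : ℕ → ℕ → Set
  Near a b = a ≤ suc b × b ≤ suc a

  near-sym : ∀ {a b} → Near a b → Near b a
  near-sym (a≤ , b≤) = b≤ , a≤

  near-refl : ∀ a → Near a a
  near-refl a = n≤1+n a , n≤1+n a

  near-≡ : ∀ {a b} → a ≡ b → Near a b
  near-≡ {a} refl = near-refl a

  near-suc : ∀ a → Near a (suc a)
  near-suc a = m≤n⇒m≤1+n (n≤1+n a) , ≤-refl

  near-suc-suc : ∀ {a b} → Near a b → Near (suc a) (suc b)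
  near-suc-suc (a≤ , b≤) = s≤s a≤ , s≤s b≤

  near-⊓ : ∀ {a b c d} → Near a b → Near c d → Near (a ⊓ c) (b ⊓ d)
  near-⊓ (a≤ , b≤) (c≤ , d≤) = ⊓-mono-≤ a≤ c≤ , ⊓-mono-≤ b≤ d≤

  near-∸ : ∀ k a → Near (k ∸ a) (k ∸ suc a)
  near-∸ k a = k∸a≤1+k∸1+a k a , ≤-trans (∸-monoʳ-≤ k (n≤1+n a)) (n≤1+n _)
    where
    k∸a≤1+k∸1+a : ∀ k a → k ∸ a ≤ suc (k ∸ suc a)
    k∸a≤1+k∸1+a zero    zero    = z≤n
    k∸a≤1+k∸1+a zero    (suc a) = z≤n
    k∸a≤1+k∸1+a (suc k) zero    = ≤-refl
    k∸a≤1+k∸1+a (suc k) (suc a) = k∸a≤1+k∸1+a k a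

  near-∣-∣ : ∀ a m → Near ∣ a - m ∣ ∣ suc a - m ∣
  near-∣-∣ zero    zero    = near-suc 0
  near-∣-∣ zero    (suc m) = near-sym (near-suc m)
  near-∣-∣ (suc a) zero    = near-suc (suc a)
  near-∣-∣ (suc a) (suc m) = near-∣-∣ a m

  ∣-∣-suc-≢ : ∀ a m → ∣ a - m ∣ ≢ ∣ suc a - m ∣
  ∣-∣-suc-≢ zero    zero    ()
  ∣-∣-suc-≢ zero    (suc m) e = <-irrefl (sym e) ≤-refl
  ∣-∣-suc-≢ (suc a) zero    ()
  ∣-∣-suc-≢ (suc a) (suc m) = ∣-∣-suc-≢ a m

  data EvenOdd : ℕ → Set where
    even : ∀ a → EvenOdd (a + a)
    odd  : ∀ a → EvenOdd (suc (a + a))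

  evenOdd : ∀ d → EvenOdd d
  evenOdd zero = even 0
  evenOdd (suc d) with evenOdd d
  ... | even a = odd a
  ... | odd a  = subst EvenOdd (cong suc (+-suc a a)) (even (suc a))

  halve : ℕ → ℕ × Bool
  halve zero          = 0 , false
  halve (suc zero)    = 0 , true
  halve (suc (suc d)) = map₁ suc (halve d)

  halve-even : ∀ a → halve (a + a) ≡ (a , false)
  halve-even zero    = refl
  halve-even (suc a) rewrite +-suc a a | halve-even a = refl

  halve-odd : ∀ a → halve (suc (a + a)) ≡ (a , true)
  halve-odd zero    = refl
  halve-odd (suc a) rewrite +-suc a a | halve-odd a = refl

  double-injective : ∀ a b → a + a ≡ b + b → a ≡ b
  double-injective a b e = trans (n≡⌊n+n/2⌋ a) (trans (cong ⌊_/2⌋ e) (sym (n≡⌊n+n/2⌋ b)))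

  half-< : ∀ {x y} → x + x < y + y → x < y
  half-< {x} {y} lt with x <? y
  ... | yes x<y = x<y
  ... | no x≮y = contradiction (+-mono-≤ (≮⇒≥ x≮y) (≮⇒≥ x≮y)) (<⇒≱ lt)

  half-≤ : ∀ {x y} → x + x ≤ y + y → x ≤ y
  half-≤ {x} {y} le with x ≤? y
  ... | yes x≤y = x≤y
  ... | no x≰y = contradiction le (<⇒≱ (+-mono-< (≰⇒> x≰y) (≰⇒> x≰y)))

  double≢suc-double : ∀ a b → a + a ≢ suc (b + b)
  double≢suc-double (suc a) zero    e rewrite +-suc a a with e
  ... | ()
  double≢suc-double (suc a) (suc b) e rewrite +-suc a a | +-suc b b =
    double≢suc-double a b (suc-injective (suc-injective e))

  -- The distance in T_{2p}⟨2,p⟩, p = 2m+1, between vertices whose labels differ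
  -- by δ < 2p.  An even δ = 2a takes a steps of 2, or two steps of p and p - a
  -- steps of 2 back (K - a moves); an odd δ = 2a+1 takes one step of p and
  -- |a - m| steps of 2.
  module Distance (m : ℕ) where

    p : ℕ
    p = suc (m + m)

    K : ℕ
    K = suc (suc p)

    Deven : ℕ → ℕ
    Deven a = a ⊓ (K ∸ a)

    Dodd : ℕ → ℕ
    Dodd a = suc ∣ a - m ∣

    Dhalf : ℕ × Bool → ℕ
    Dhalf (a , false) = Deven a
    Dhalf (a , true)  = Dodd a

    D : ℕ → ℕ
    D δ = Dhalf (halve δ)

    D-even : ∀ a → D (a + a) ≡ Deven a
    D-even a rewrite halve-even a = refl

    D-odd : ∀ a → D (suc (a + a)) ≡ Dodd a
    D-odd a rewrite halve-odd a = refl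

    D-2+even : ∀ a → D (suc (suc (a + a))) ≡ Deven (suc a)
    D-2+even a rewrite halve-even a = refl

    D-2+odd : ∀ a → D (suc (suc (suc (a + a)))) ≡ Dodd (suc a)
    D-2+odd a rewrite halve-odd a = refl

    Deven-small : ∀ a → a ≤ suc m → Deven a ≡ a
    Deven-small a a≤ = m≤n⇒m⊓n≡m (m+n≤o⇒m≤o∸n a
      (≤-trans (+-mono-≤ a≤ a≤) (≤-trans (≤-reflexive (+-suc (suc m) m)) (n≤1+n _))))

    Deven-large : ∀ e → Deven (suc (suc (m + e))) ≡ suc m ∸ e
    Deven-large e = trans (cong (suc (suc (m + e)) ⊓_) K∸a)
      (m≥n⇒m⊓n≡n (≤-trans (m∸n≤m (suc m) e) (≤-trans (s≤s (m≤m+n m e)) (n≤1+n _))))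
      where
      K∸a : K ∸ suc (suc (m + e)) ≡ suc m ∸ e
      K∸a = trans (cong (_∸ (m + e)) (sym (+-suc m m))) ([m+n]∸[m+o]≡n∸o m (suc m) e)

    Dodd-below : ∀ a e → a + e ≡ m → Dodd a ≡ suc e
    Dodd-below a e refl = cong suc (∣m-m+n∣≡n a e)

    Dodd-above : ∀ e → Dodd (m + e) ≡ suc e
    Dodd-above e = cong suc (trans (∣-∣-comm (m + e) m) (∣m-m+n∣≡n m e))

    Deven-large≡suc-Dodd : ∀ e → suc (suc e) ≤ m → Deven (suc (suc (m + e))) ≡ suc (Dodd (suc e))
    Deven-large≡suc-Dodd e 2+e≤m with m≤n⇒∃[o]m+o≡n 2+e≤m
    ... | f , refl = begin
      Deven (suc (suc (m + e)))          ≡⟨ Deven-large e ⟩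
      suc (suc (suc e) + f) ∸ e          ≡⟨ 3+e+f∸e e f ⟩
      suc (suc (suc f))                  ≡⟨ cong suc (sym (Dodd-below (suc e) (suc f) (+-suc (suc e) f))) ⟩
      suc (Dodd (suc e))                 ∎
      where
      open ≡-Reasoning
      3+e+f∸e : ∀ e f → suc (suc (suc e) + f) ∸ e ≡ suc (suc (suc f))
      3+e+f∸e zero    f = refl
      3+e+f∸e (suc e) f = 3+e+f∸e e f

    small⊎large : ∀ a → a ≤ suc m ⊎ ∃ λ e → a ≡ suc (suc (m + e))
    small⊎large a with a ≤? suc m
    ... | yes a≤ = inj₁ a≤
    ... | no a≰ with m≤n⇒∃[o]m+o≡n (≰⇒> a≰)
    ...   | e , eq = inj₂ (e , sym eq)

    even-in-range : ∀ a → a + a < p + p → a ≤ m + m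
    even-in-range a lt = ≤-pred (half-< lt)

    odd-in-range : ∀ a → suc (a + a) < p + p → a ≤ m + m
    odd-in-range a lt = even-in-range a (<-trans (n<1+n _) lt)

    large-in-range : ∀ e → suc (suc (m + e)) ≤ m + m → suc (suc e) ≤ m
    large-in-range e le = +-cancelˡ-≤ m (suc (suc e)) m
      (≤-trans (≤-reflexive (trans (+-suc m (suc e)) (cong suc (+-suc m e)))) le)

    D-1 : D 1 ≡ suc m
    D-1 = refl

    D-1+p : D (suc p) ≡ suc m
    D-1+p = trans (D-2+even m) (Deven-small (suc m) ≤-refl)

    D≡0⇒≡0 : ∀ δ → δ < p + p → D δ ≡ 0 → δ ≡ 0
    D≡0⇒≡0 δ lt D≡0 with evenOdd δ
    ... | odd a rewrite D-odd a with D≡0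
    ...   | ()
    D≡0⇒≡0 δ lt D≡0 | even a rewrite D-even a with small⊎large a
    ... | inj₁ a≤ rewrite Deven-small a a≤ | D≡0 = refl
    ... | inj₂ (e , refl) rewrite Deven-large e =
      contradiction (≤-trans (large-in-range e (even-in-range _ lt)) (≤-trans (n≤1+n m) (m∸n≡0⇒m≤n D≡0)))
                    (λ 2+e≤e → 1+n≰n (≤-trans (n≤1+n (suc e)) 2+e≤e))

    D<2p : ∀ δ → δ < p + p → D δ < p + p
    D<2p δ lt with evenOdd δ
    ... | even a rewrite D-even a = ≤-<-trans (m⊓n≤m a (K ∸ a)) (≤-<-trans (m≤m+n a a) lt)
    ... | odd a rewrite D-odd a =
      ≤-<-trans (s≤s (≤-trans (∣m-n∣≤m⊔n a m) (⊔-lub (odd-in-range a lt) (m≤m+n m m))))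
                (m<m+n p (s≤s z≤n))

    D-+2 : ∀ δ → Near (D δ) (D (suc (suc δ)))
    D-+2 δ with halve δ
    ... | a , false = near-⊓ (near-suc a) (near-∸ K a)
    ... | a , true  = near-suc-suc (near-∣-∣ a m)

    D-+p : ∀ δ → δ + p < p + p → (δ ≡ 1 × D (δ + p) ≡ D δ) ⊎ D (δ + p) ≡ suc (D δ)
    D-+p δ lt with evenOdd δ
    ... | even a = inj₂ (begin
      D (a + a + p)                 ≡⟨ cong D (rearrange a m) ⟩
      D (suc ((m + a) + (m + a)))   ≡⟨ D-odd (m + a) ⟩
      Dodd (m + a)                  ≡⟨ Dodd-above a ⟩
      suc a                         ≡⟨ cong suc (sym (Deven-small a (≤-trans a≤m (n≤1+n m)))) ⟩
      suc (Deven a)                 ≡⟨ cong suc (sym (D-even a)) ⟩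
      suc (D (a + a))               ∎)
      where
      open ≡-Reasoning
      a≤m : a ≤ m
      a≤m = half-≤ (≤-pred (+-cancelʳ-< p (a + a) p lt))
      rearrange : ∀ a m → a + a + suc (m + m) ≡ suc ((m + a) + (m + a))
      rearrange = solve-∀
    ... | odd zero = inj₁ (refl , trans D-1+p (sym D-1))
    ... | odd (suc a) = inj₂ (begin
      D (suc (suc a + suc a) + p)                      ≡⟨ cong D (rearrange a m) ⟩
      D (suc (suc (m + a)) + suc (suc (m + a)))        ≡⟨ D-even _ ⟩
      Deven (suc (suc (m + a)))                        ≡⟨ Deven-large≡suc-Dodd a 2+a≤m ⟩
      suc (Dodd (suc a))                               ≡⟨ cong suc (sym (D-odd (suc a))) ⟩
      suc (D (suc (suc a + suc a)))                    ∎)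
      where
      open ≡-Reasoning
      2+a≤m : suc (suc a) ≤ m
      2+a≤m = half-< (≤-pred (+-cancelʳ-< p _ p lt))
      rearrange : ∀ a m → suc (suc a + suc a) + suc (m + m) ≡ suc (suc (m + a)) + suc (suc (m + a))
      rearrange = solve-∀

    D-odd≡suc-D-even : ∀ a b → a + b ≡ m → D (suc (a + a)) ≡ suc (D (b + b))
    D-odd≡suc-D-even a b a+b≡m
      rewrite D-odd a | Dodd-below a b a+b≡m | D-even b
            | Deven-small b (≤-trans (m≤n+m b a) (≤-trans (≤-reflexive a+b≡m) (n≤1+n m))) = refl

    -- δ + ε = p forces opposite parities, and then the two halves add up to m.
    D-complement : ∀ δ ε → δ + ε ≡ p → D ε ≡ suc (D δ) ⊎ D δ ≡ suc (D ε)
    D-complement δ ε δ+ε≡p with evenOdd δ | evenOdd ε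
    ... | even a | even b = contradiction (trans (sym (rearrange a b)) δ+ε≡p) (double≢suc-double (a + b) m)
      where
      rearrange : ∀ a b → a + a + (b + b) ≡ (a + b) + (a + b)
      rearrange = solve-∀
    ... | odd a | odd b = contradiction (trans (sym (rearrange a b)) δ+ε≡p) (double≢suc-double (suc (a + b)) m)
      where
      rearrange : ∀ a b → suc (a + a) + suc (b + b) ≡ suc (a + b) + suc (a + b)
      rearrange = solve-∀
    ... | even a | odd b = inj₁ (D-odd≡suc-D-even b a (trans (+-comm b a) a+b≡m))
      where
      rearrange : ∀ a b → a + a + suc (b + b) ≡ suc ((a + b) + (a + b))
      rearrange = solve-∀
      a+b≡m : a + b ≡ m
      a+b≡m = double-injective _ _ (suc-injective (trans (sym (rearrange a b)) δ+ε≡p))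
    ... | odd a | even b = inj₂ (D-odd≡suc-D-even a b a+b≡m)
      where
      rearrange : ∀ a b → suc (a + a) + (b + b) ≡ suc ((a + b) + (a + b))
      rearrange = solve-∀
      a+b≡m : a + b ≡ m
      a+b≡m = double-injective _ _ (suc-injective (trans (sym (rearrange a b)) δ+ε≡p))

    -- The ways a shortest walk covering difference δ can end: with a two-step,
    -- with a p-step, or with a p-step back across the start from difference
    -- ε = p - δ; in the last case a two-step away from the start also shortens.
    Predecessor : ℕ → Set
    Predecessor δ =
        (∃ λ δ′ → δ ≡ suc (suc δ′) × D δ ≡ suc (D δ′))
      ⊎ (∃ λ δ′ → δ ≡ δ′ + p × D δ ≡ suc (D δ′))
      ⊎ (∃ λ ε → δ + ε ≡ p × D δ ≡ suc (D ε) × D δ ≡ suc (D (suc (suc δ))))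

    predecessor-even : ∀ a → suc a + suc a < p + p → Predecessor (suc a + suc a)
    predecessor-even a lt with small⊎large (suc a)
    ... | inj₁ 1+a≤ = inj₁ (a + a , cong suc (+-suc a a) , D≡1+D)
      where
      D≡1+D : D (suc a + suc a) ≡ suc (D (a + a))
      D≡1+D rewrite D-even (suc a) | Deven-small (suc a) 1+a≤ | D-even a
                  | Deven-small a (≤-trans (n≤1+n a) 1+a≤) = refl
    ... | inj₂ (e , refl) = inj₂ (inj₁ (suc (suc e + suc e) , rearrange m e , (begin
      D (suc (suc (m + e)) + suc (suc (m + e)))   ≡⟨ D-even _ ⟩
      Deven (suc (suc (m + e)))                   ≡⟨ Deven-large≡suc-Dodd e (large-in-range e (even-in-range _ lt)) ⟩
      suc (Dodd (suc e))                          ≡⟨ cong suc (sym (D-odd (suc e))) ⟩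
      suc (D (suc (suc e + suc e)))               ∎)))
      where
      open ≡-Reasoning
      rearrange : ∀ m e → suc (suc (m + e)) + suc (suc (m + e)) ≡ suc (suc e + suc e) + suc (m + m)
      rearrange = solve-∀

    predecessor-odd : ∀ a → suc (a + a) < p + p → Predecessor (suc (a + a))
    predecessor-odd a lt with a <? m
    ... | no a≮m with m≤n⇒∃[o]m+o≡n (≮⇒≥ a≮m)
    ...   | e , refl = inj₂ (inj₁ (e + e , rearrange m e , D≡1+D))
      where
      rearrange : ∀ m e → suc ((m + e) + (m + e)) ≡ (e + e) + suc (m + m)
      rearrange = solve-∀
      e≤1+m : e ≤ suc m
      e≤1+m = ≤-trans (+-cancelˡ-≤ m e m (odd-in-range _ lt)) (n≤1+n m)
      D≡1+D : D (suc ((m + e) + (m + e))) ≡ suc (D (e + e))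
      D≡1+D rewrite D-odd (m + e) | Dodd-above e | D-even e | Deven-small e e≤1+m = refl
    predecessor-odd a lt | yes a<m with m≤n⇒∃[o]m+o≡n a<m
    ... | e , 1+a+e≡m = inj₂ (inj₂ (suc e + suc e , δ+ε≡p , D-odd≡suc-D-even a (suc e) a+1+e≡m , D≡1+D-2+))
      where
      a+1+e≡m : a + suc e ≡ m
      a+1+e≡m = trans (+-suc a e) 1+a+e≡m
      rearrange : ∀ a e → suc (a + a) + (suc e + suc e) ≡ suc ((a + suc e) + (a + suc e))
      rearrange = solve-∀
      δ+ε≡p : suc (a + a) + (suc e + suc e) ≡ p
      δ+ε≡p = trans (rearrange a e) (cong (λ x → suc (x + x)) a+1+e≡m)
      D≡1+D-2+ : D (suc (a + a)) ≡ suc (D (suc (suc (suc (a + a)))))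
      D≡1+D-2+ rewrite D-2+odd a | D-odd a | Dodd-below a (suc e) a+1+e≡m | Dodd-below (suc a) e 1+a+e≡m = refl

    predecessor : ∀ δ → 0 < δ → δ < p + p → Predecessor δ
    predecessor δ δ>0 lt with evenOdd δ
    predecessor δ () lt | even zero
    ... | even (suc a) = predecessor-even a lt
    ... | odd a        = predecessor-odd a lt

    -- The two branches of Deven cross between a = m + 1 and a = m + 2, which
    -- gives the only two-step that leaves D unchanged.
    D-+2-flat : ∀ δ → suc (suc δ) < p + p → D δ ≡ D (suc (suc δ)) → δ ≡ suc m + suc m
    D-+2-flat δ lt flat with evenOdd δ
    ... | odd a = contradiction (suc-injective (trans (sym (D-odd a)) (trans flat (D-2+odd a)))) (∣-∣-suc-≢ a m)
    ... | even a with small⊎large a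
    ...   | inj₂ (e , refl) = contradiction
      (trans (sym Dδ≡1+m∸e) (trans (sym (D-even _)) (trans flat (trans (D-2+even _) D[2+δ]≡m∸e))))
      1+n≢n
      where
      e≤m : e ≤ m
      e≤m = ≤-trans (n≤1+n e) (≤-trans (n≤1+n (suc e))
              (large-in-range e (even-in-range _ (<-trans (<-trans (n<1+n _) (n<1+n _)) lt))))
      Dδ≡1+m∸e : Deven (suc (suc (m + e))) ≡ suc (m ∸ e)
      Dδ≡1+m∸e = trans (Deven-large e) (+-∸-assoc 1 e≤m)
      D[2+δ]≡m∸e : Deven (suc (suc (suc (m + e)))) ≡ m ∸ e
      D[2+δ]≡m∸e = trans (cong (λ x → Deven (suc (suc x))) (sym (+-suc m e))) (Deven-large (suc e))
    ...   | inj₁ a≤ with m≤n⇒m<n∨m≡n a≤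
    ...     | inj₂ refl = refl
    ...     | inj₁ (s≤s a≤m) = contradiction
      (sym (trans (sym (Deven-small a (≤-trans a≤m (n≤1+n m))))
           (trans (sym (D-even a)) (trans flat (trans (D-2+even a) (Deven-small (suc a) (s≤s a≤m)))))))
      1+n≢n


module Positions where

  open import Data.Nat
  open import Data.Nat.Properties
  open import Data.Nat.Tactic.RingSolver using (solve-∀)
  open import Data.Product using (_×_; _,_; proj₁; proj₂; ∃)
  open import Function using (_∘_)
  open import Data.Sum using (_⊎_; inj₁; inj₂)
  open import Relation.Binary.PropositionalEquality
  open import Relation.Nullary using (yes; no; contradiction)
  open Difference

  ∣m+n-m∣≡n : ∀ m n → ∣ m + n - m ∣ ≡ n
  ∣m+n-m∣≡n m n = trans (∣-∣-comm (m + n) m) (∣m-m+n∣≡n m n)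

  ∣n-1+n∣≡1 : ∀ n → ∣ n - suc n ∣ ≡ 1
  ∣n-1+n∣≡1 n = trans (cong (∣ n -_∣) (+-comm 1 n)) (∣m-m+n∣≡n n 1)

  ∣1+n-n∣≡1 : ∀ n → ∣ suc n - n ∣ ≡ 1
  ∣1+n-n∣≡1 n = trans (∣-∣-comm (suc n) n) (∣n-1+n∣≡1 n)

  ∣n-2+n∣≡2 : ∀ n → ∣ n - suc (suc n) ∣ ≡ 2
  ∣n-2+n∣≡2 n = trans (cong (∣ n -_∣) (+-comm 2 n)) (∣m-m+n∣≡n n 2)

  m+n≡k⇒∣m-k∣≡n : ∀ {m n k} → m + n ≡ k → ∣ m - k ∣ ≡ n
  m+n≡k⇒∣m-k∣≡n {m} {n} refl = ∣m-m+n∣≡n m n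

  ∣-∣≡⇒+≡ : ∀ a b {s} → ∣ a - b ∣ ≡ s → a + s ≡ b ⊎ b + s ≡ a
  ∣-∣≡⇒+≡ a b refl with ≤-total a b
  ... | inj₁ a≤b with m≤n⇒∃[o]m+o≡n a≤b
  ...   | d , refl = inj₁ (cong (a +_) (∣m-m+n∣≡n a d))
  ∣-∣≡⇒+≡ a b refl | inj₂ b≤a with m≤n⇒∃[o]m+o≡n b≤a
  ...   | d , refl = inj₂ (cong (b +_) (∣m+n-m∣≡n b d))

  2+a+1+b≢2 : ∀ a b → suc (suc a) + suc b ≢ 2
  2+a+1+b≢2 a b eq = 0≢1+n (sym (suc-injective (suc-injective (trans (cong (suc ∘ suc) (sym (+-suc a b))) eq))))

  data Side (x y s : ℕ) : Set where
    before  : ∀ d → x + d ≡ y → Side x y s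
    after   : ∀ d → y + s + d ≡ x → Side x y s
    between : ∀ d e → suc d + suc e ≡ s → y + suc d ≡ x → Side x y s

  side : ∀ x y s → Side x y s
  side x y s with x ≤? y
  ... | yes x≤y with m≤n⇒∃[o]m+o≡n x≤y
  ...   | d , eq = before d eq
  side x y s | no x≰y with y + s ≤? x
  ... | yes y+s≤x with m≤n⇒∃[o]m+o≡n y+s≤x
  ...   | d , eq = after d eq
  side x y s | no x≰y | no y+s≰x with m≤n⇒∃[o]m+o≡n (<⇒≤ (≰⇒> x≰y)) | m≤n⇒∃[o]m+o≡n (<⇒≤ (≰⇒> y+s≰x))
  ... | zero , eq | _ = contradiction (≤-reflexive (trans (sym eq) (+-identityʳ y))) x≰y
  ... | suc d , _ | zero , eq = contradiction (≤-reflexive (trans (sym eq) (+-identityʳ x))) y+s≰x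
  ... | suc d , eq₁ | suc e , eq₂ =
    between d e (+-cancelˡ-≡ y _ _ (trans (sym (+-assoc y (suc d) (suc e))) (trans (cong (_+ suc e) eq₁) eq₂))) eq₁

  before-distances : ∀ x d s → ∣ x - x + d ∣ ≡ d × ∣ x - (x + d) + s ∣ ≡ d + s
  before-distances x d s = ∣m-m+n∣≡n x d , trans (cong (∣ x -_∣) (+-assoc x d s)) (∣m-m+n∣≡n x (d + s))

  after-distances : ∀ y s d → ∣ y + s + d - y ∣ ≡ s + d × ∣ y + s + d - y + s ∣ ≡ d
  after-distances y s d = trans (cong (∣_- y ∣) (+-assoc y s d)) (∣m+n-m∣≡n y (s + d)) , ∣m+n-m∣≡n (y + s) d

  module Edges (m : ℕ) (1≤m : 1 ≤ m) where
    open Distance m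

    N : ℕ
    N = p + p

    2≤p : 2 ≤ p
    2≤p = s≤s (≤-trans 1≤m (m≤m+n m m))

    Step : ℕ → Set
    Step s = s ≡ 2 ⊎ s ≡ p

    D-near-step : ∀ δ {s} → Step s → δ + s < N → Near (D δ) (D (δ + s))
    D-near-step δ (inj₁ refl) _ = subst (λ t → Near (D δ) (D t)) (+-comm 2 δ) (D-+2 δ)
    D-near-step δ (inj₂ refl) lt with D-+p δ lt
    ... | inj₁ (_ , same) = near-≡ (sym same)
    ... | inj₂ next       = subst (Near (D δ)) (sym next) (near-suc (D δ))

    D-near-complement : ∀ δ ε → δ + ε ≡ p → Near (D δ) (D ε)
    D-near-complement δ ε δ+ε≡p with D-complement δ ε δ+ε≡p
    ... | inj₁ next = subst (Near (D δ)) (sym next) (near-suc (D δ))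
    ... | inj₂ next = subst (λ t → Near t (D ε)) (sym next) (near-sym (near-suc (D ε)))

    D-near-cong : ∀ {a a′ b b′} → a ≡ a′ → b ≡ b′ → Near (D a′) (D b′) → Near (D a) (D b)
    D-near-cong refl refl near = near

    D-near-between : ∀ d e {s} → Step s → suc d + suc e ≡ s → Near (D (suc d)) (D (suc e))
    D-near-between d e (inj₂ refl) d+e≡p = D-near-complement (suc d) (suc e) d+e≡p
    D-near-between zero zero (inj₁ refl) _ = near-refl (D 1)
    D-near-between (suc d) e (inj₁ refl) eq = contradiction eq (2+a+1+b≢2 d e)

    D-near-along-edge : ∀ x y {s} → Step s → x < N → y + s < N → Near (D ∣ x - y ∣) (D ∣ x - (y + s) ∣)
    D-near-along-edge x y {s} step x<N y+s<N with side x y s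
    ... | before d refl =
      D-near-cong (proj₁ (before-distances x d s)) (proj₂ (before-distances x d s))
        (D-near-step d step (≤-<-trans (m≤n+m (d + s) x) (subst (_< N) (+-assoc x d s) y+s<N)))
    ... | after d refl =
      D-near-cong (trans (proj₁ (after-distances y s d)) (+-comm s d)) (proj₂ (after-distances y s d))
        (near-sym (D-near-step d step (subst (_< N) (+-comm s d)
          (≤-<-trans (m≤n+m (s + d) y) (subst (_< N) (+-assoc y s d) x<N)))))
    ... | between d e d+e≡s refl =
      D-near-cong (∣m+n-m∣≡n y (suc d)) (trans (∣m+n-m+o∣≡∣n-o∣ y (suc d) s) (m+n≡k⇒∣m-k∣≡n {suc d} {suc e} d+e≡s))
        (D-near-between d e step d+e≡s)

    transport-D : ∀ {a a′ b b′} → a ≡ a′ → b ≡ b′ → D a ≡ D b → D a′ ≡ D b′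
    transport-D refl refl eq = eq

    2+2m : ℕ
    2+2m = suc m + suc m

    equidistant-2 : ∀ x y → x < N → y + 2 < N → D ∣ x - y ∣ ≡ D ∣ x - (y + 2) ∣ →
                    x + 2+2m ≡ y ⊎ x ≡ suc y ⊎ y + 2 + 2+2m ≡ x
    equidistant-2 x y x<N y+2<N eq with side x y 2
    ... | before d refl = inj₁ (cong (x +_) (sym (D-+2-flat d 2+d<N
            (transport-D (proj₁ (before-distances x d 2)) (trans (proj₂ (before-distances x d 2)) (+-comm d 2)) eq))))
      where
      2+d<N : suc (suc d) < N
      2+d<N = subst (_< N) (+-comm d 2) (≤-<-trans (m≤n+m (d + 2) x) (subst (_< N) (+-assoc x d 2) y+2<N))
    ... | after d refl = inj₂ (inj₂ (cong (y + 2 +_) (sym (D-+2-flat d 2+d<N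
            (transport-D (proj₂ (after-distances y 2 d)) (proj₁ (after-distances y 2 d)) (sym eq))))))
      where
      2+d<N : suc (suc d) < N
      2+d<N = ≤-<-trans (m≤n+m (2 + d) y) (subst (_< N) (+-assoc y 2 d) x<N)
    ... | between zero    zero    _  refl = inj₂ (inj₁ (+-comm y 1))
    ... | between (suc d) e       eq′ refl = contradiction eq′ (2+a+1+b≢2 d e)

    equidistant-p : ∀ x y → x < N → y + p < N → D ∣ x - y ∣ ≡ D ∣ x - (y + p) ∣ →
                    x + 1 ≡ y ⊎ y + p + 1 ≡ x
    equidistant-p x y x<N y+p<N eq with side x y p
    ... | before d refl with D-+p d d+p<N
      where
      d+p<N : d + p < N
      d+p<N = ≤-<-trans (m≤n+m (d + p) x) (subst (_< N) (+-assoc x d p) y+p<N)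
    ...   | inj₁ (refl , _) = inj₁ refl
    ...   | inj₂ next = contradiction (trans (sym next)
            (sym (transport-D (proj₁ (before-distances x d p)) (proj₂ (before-distances x d p)) eq))) 1+n≢n
    equidistant-p x y x<N y+p<N eq | after d refl with D-+p d d+p<N
      where
      d+p<N : d + p < N
      d+p<N = subst (_< N) (+-comm p d) (≤-<-trans (m≤n+m (p + d) y) (subst (_< N) (+-assoc y p d) x<N))
    ...   | inj₁ (refl , _) = inj₂ refl
    ...   | inj₂ next = contradiction (trans (sym next)
            (transport-D (trans (proj₁ (after-distances y p d)) (+-comm p d)) (proj₂ (after-distances y p d)) eq)) 1+n≢n
    equidistant-p x y x<N y+p<N eq | between d e d+e≡p refl
      with D-complement (suc d) (suc e) d+e≡p
         | transport-D (∣m+n-m∣≡n y (suc d)) (trans (∣m+n-m+o∣≡∣n-o∣ y (suc d) p) (m+n≡k⇒∣m-k∣≡n {suc d} {suc e} d+e≡p)) eq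
    ... | inj₁ next | same = contradiction (trans (sym next) (sym same)) 1+n≢n
    ... | inj₂ next | same = contradiction (trans (sym next) same) 1+n≢n

    CloserNeighbour : ℕ → ℕ → Set
    CloserNeighbour x z = ∃ λ y → y < N × Step ∣ y - z ∣ × suc (D ∣ x - y ∣) ≡ D ∣ x - z ∣

    closer : ∀ x y z {a b} → ∣ x - y ∣ ≡ a → ∣ x - z ∣ ≡ b → D b ≡ suc (D a) → suc (D ∣ x - y ∣) ≡ D ∣ x - z ∣
    closer x y z refl refl D≡ = sym D≡

    closer-neighbour-right : ∀ x d → 0 < d → x + d < N → CloserNeighbour x (x + d)
    closer-neighbour-right x d d>0 x+d<N
      with predecessor d d>0 (≤-<-trans (m≤n+m d x) x+d<N)
    ... | inj₁ (d′ , refl , D≡) =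
      x + d′ , ≤-<-trans (+-monoʳ-≤ x (≤-trans (n≤1+n d′) (n≤1+n (suc d′)))) x+d<N ,
      inj₁ (trans (∣m+n-m+o∣≡∣n-o∣ x d′ (suc (suc d′))) (∣n-2+n∣≡2 d′)) ,
      closer x (x + d′) (x + d) (∣m-m+n∣≡n x d′) (∣m-m+n∣≡n x _) D≡
    ... | inj₂ (inj₁ (d′ , refl , D≡)) =
      x + d′ , ≤-<-trans (+-monoʳ-≤ x (m≤m+n d′ p)) x+d<N ,
      inj₂ (trans (∣m+n-m+o∣≡∣n-o∣ x d′ (d′ + p)) (∣m-m+n∣≡n d′ p)) ,
      closer x (x + d′) (x + d) (∣m-m+n∣≡n x d′) (∣m-m+n∣≡n x _) D≡
    ... | inj₂ (inj₂ (e , d+e≡p , D≡ , D≡′)) with p ≤? x + d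
    ...   | no p≰x+d =
      x + suc (suc d) , x+2+d<N ,
      inj₁ (trans (∣m+n-m+o∣≡∣n-o∣ x (suc (suc d)) d) (trans (∣-∣-comm (suc (suc d)) d) (∣n-2+n∣≡2 d))) ,
      closer x (x + suc (suc d)) (x + d) (∣m-m+n∣≡n x _) (∣m-m+n∣≡n x d) D≡′
      where
      rearrange : ∀ x d → suc (x + suc (suc d)) ≡ suc (x + d) + 2
      rearrange = solve-∀
      x+2+d<N : x + suc (suc d) < N
      x+2+d<N = ≤-trans (≤-reflexive (rearrange x d)) (≤-trans (+-monoˡ-≤ 2 (≰⇒> p≰x+d)) (+-monoʳ-≤ p 2≤p))
    ...   | yes p≤x+d with m≤n⇒∃[o]m+o≡n p≤x+d
    ...     | y , p+y≡x+d =
      y , ≤-<-trans (≤-trans (m≤n+m y p) (≤-reflexive p+y≡x+d)) x+d<N ,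
      inj₂ (trans (cong (∣ y -_∣) (trans (sym p+y≡x+d) (+-comm p y))) (∣m-m+n∣≡n y p)) ,
      closer x y (x + d) ∣x-y∣≡e (∣m-m+n∣≡n x d) D≡
      where
      rearrange : ∀ d e y → d + e + y ≡ y + e + d
      rearrange = solve-∀
      x≡y+e : x ≡ y + e
      x≡y+e = +-cancelʳ-≡ d x (y + e) (trans (sym p+y≡x+d) (trans (cong (_+ y) (sym d+e≡p)) (rearrange d e y)))
      ∣x-y∣≡e : ∣ x - y ∣ ≡ e
      ∣x-y∣≡e = trans (cong (∣_- y ∣) x≡y+e) (∣m+n-m∣≡n y e)

    closer-neighbour-left : ∀ z d → 0 < d → z + d < N → CloserNeighbour (z + d) z
    closer-neighbour-left z d d>0 z+d<N
      with predecessor d d>0 (≤-<-trans (m≤n+m d z) z+d<N)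
    ... | inj₁ (d′ , refl , D≡) =
      z + 2 , ≤-<-trans (+-monoʳ-≤ z (s≤s (s≤s z≤n))) z+d<N , inj₁ (∣m+n-m∣≡n z 2) ,
      closer (z + d) (z + 2) z (trans (∣m+n-m+o∣≡∣n-o∣ z (suc (suc d′)) 2) (∣-∣-identityʳ d′))
             (∣m+n-m∣≡n z _) D≡
    ... | inj₂ (inj₁ (d′ , refl , D≡)) =
      z + p , ≤-<-trans (+-monoʳ-≤ z (m≤n+m p d′)) z+d<N , inj₂ (∣m+n-m∣≡n z p) ,
      closer (z + d) (z + p) z (trans (∣m+n-m+o∣≡∣n-o∣ z (d′ + p) p) (trans (cong (∣_- p ∣) (+-comm d′ p)) (∣m+n-m∣≡n p d′)))
             (∣m+n-m∣≡n z _) D≡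
    ... | inj₂ (inj₂ (e , d+e≡p , D≡ , D≡′)) with p ≤? z
    ...   | no p≰z =
      z + p , +-monoˡ-< p (≰⇒> p≰z) , inj₂ (∣m+n-m∣≡n z p) ,
      closer (z + d) (z + p) z (trans (∣m+n-m+o∣≡∣n-o∣ z d p) (m+n≡k⇒∣m-k∣≡n {d} {e} d+e≡p))
             (∣m+n-m∣≡n z d) D≡
    ...   | yes p≤z with m≤n⇒∃[o]m+o≡n (≤-trans 2≤p p≤z)
    ...     | y , refl =
      y , ≤-<-trans (≤-trans (m≤n+m y 2) (m≤m+n (2 + y) d)) z+d<N ,
      inj₁ (trans (cong (∣ y -_∣) (+-comm 2 y)) (∣m-m+n∣≡n y 2)) ,
      closer (2 + y + d) y (2 + y) (trans (cong (∣_- y ∣) (rearrange y d)) (∣m+n-m∣≡n y (2 + d)))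
             (∣m+n-m∣≡n (2 + y) d) D≡′
      where
      rearrange : ∀ y d → 2 + y + d ≡ y + (2 + d)
      rearrange = solve-∀

    closer-neighbour : ∀ x z → x < N → z < N → 0 < ∣ x - z ∣ → CloserNeighbour x z
    closer-neighbour x z x<N z<N ∣x-z∣>0 with ≤-total x z
    ... | inj₁ x≤z with m≤n⇒∃[o]m+o≡n x≤z
    ...   | d , refl = closer-neighbour-right x d (subst (0 <_) (∣m-m+n∣≡n x d) ∣x-z∣>0) z<N
    closer-neighbour x z x<N z<N ∣x-z∣>0 | inj₂ z≤x with m≤n⇒∃[o]m+o≡n z≤x
    ...   | d , refl = closer-neighbour-left z d (subst (0 <_) (∣m+n-m∣≡n z d) ∣x-z∣>0) x<N

    EquidistantEdge : ℕ → Set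
    EquidistantEdge x = ∃ λ y → ∃ λ z → y < N × z < N × Step ∣ y - z ∣ × D ∣ x - y ∣ ≡ D ∣ x - z ∣

    -- 0 sees the edge {1, 1 + p} at distance m + 1 from both ends, x + 1 sees
    -- {x, x + 2} at distance 1, and the last vertex N - 1 sees {p - 2, N - 2}.
    equidistant-edge : ∀ x → x < N → EquidistantEdge x
    equidistant-edge zero x<N = 1 , suc p , ≤-<-trans (s≤s z≤n) 1+p<N , 1+p<N , inj₂ refl , trans D-1 (sym D-1+p)
      where
      1+p<N : suc p < N
      1+p<N = ≤-trans (≤-reflexive (+-comm 2 p)) (+-monoʳ-≤ p 2≤p)
    equidistant-edge (suc x) x<N with suc (suc x) <? N
    ... | yes 2+x<N = x , suc (suc x) , <-trans (<-trans (n<1+n x) (n<1+n _)) 2+x<N , 2+x<N ,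
                      inj₁ (∣n-2+n∣≡2 x) , cong D (trans (∣1+n-n∣≡1 x) (sym (∣n-1+n∣≡1 x)))
    ... | no 2+x≮N with m≤n⇒∃[o]m+o≡n 2≤p
    ...   | t , 2+t≡p = t , t + p , ≤-<-trans (m≤m+n t p) t+p<N , t+p<N , inj₂ (∣m-m+n∣≡n t p) , D≡D
      where
      x≡t+p : x ≡ t + p
      x≡t+p = suc-injective (suc-injective (trans (≤-antisym x<N (≮⇒≥ 2+x≮N)) (cong (_+ p) (sym 2+t≡p))))
      t+p<N : t + p < N
      t+p<N = subst (_< N) x≡t+p (<-trans (n<1+n x) x<N)
      D≡D : D ∣ suc x - t ∣ ≡ D ∣ suc x - (t + p) ∣
      D≡D rewrite x≡t+p = begin
        D ∣ suc (t + p) - t ∣     ≡⟨ cong (λ a → D ∣ a - t ∣) (sym (+-suc t p)) ⟩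
        D ∣ t + suc p - t ∣       ≡⟨ cong D (∣m+n-m∣≡n t (suc p)) ⟩
        D (suc p)                 ≡⟨ trans D-1+p (sym D-1) ⟩
        D 1                       ≡⟨ cong D (sym (∣1+n-n∣≡1 (t + p))) ⟩
        D ∣ suc (t + p) - (t + p) ∣ ∎
        where open ≡-Reasoning

    AtMostTwoEquidistant : ℕ → ℕ → Set
    AtMostTwoEquidistant y z =
      ∃ λ c₁ → ∃ λ c₂ → ∀ x → x < N → D ∣ x - y ∣ ≡ D ∣ x - z ∣ → x ≡ c₁ ⊎ x ≡ c₂

    at-most-two-equidistant : ∀ y {s} → Step s → y + s < N → AtMostTwoEquidistant y (y + s)
    at-most-two-equidistant y (inj₂ refl) y+p<N = y ∸ 1 , y + p + 1 , candidates
      where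
      candidates : ∀ x → x < N → D ∣ x - y ∣ ≡ D ∣ x - (y + p) ∣ → x ≡ y ∸ 1 ⊎ x ≡ y + p + 1
      candidates x x<N eq with equidistant-p x y x<N y+p<N eq
      ... | inj₁ refl = inj₁ (sym (m+n∸n≡m x 1))
      ... | inj₂ refl = inj₂ refl
    at-most-two-equidistant y (inj₁ refl) y+2<N with y <? 2+2m
    ... | yes y<2+2m = suc y , y + 2 + 2+2m , candidates
      where
      candidates : ∀ x → x < N → D ∣ x - y ∣ ≡ D ∣ x - (y + 2) ∣ → x ≡ suc y ⊎ x ≡ y + 2 + 2+2m
      candidates x x<N eq with equidistant-2 x y x<N y+2<N eq
      ... | inj₁ refl        = contradiction (m≤n+m 2+2m x) (<⇒≱ y<2+2m)
      ... | inj₂ (inj₁ refl) = inj₁ refl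
      ... | inj₂ (inj₂ refl) = inj₂ refl
    ... | no y≮2+2m = suc y , y ∸ 2+2m , candidates
      where
      rearrange : ∀ m → suc (m + m) + suc (m + m) + 4 ≡ (suc m + suc m) + 2 + (suc m + suc m)
      rearrange = solve-∀
      candidates : ∀ x → x < N → D ∣ x - y ∣ ≡ D ∣ x - (y + 2) ∣ → x ≡ suc y ⊎ x ≡ y ∸ 2+2m
      candidates x x<N eq with equidistant-2 x y x<N y+2<N eq
      ... | inj₁ refl        = inj₂ (sym (m+n∸n≡m x 2+2m))
      ... | inj₂ (inj₁ refl) = inj₁ refl
      ... | inj₂ (inj₂ refl) = contradiction
        (≤-trans (m≤m+n N 4) (≤-trans (≤-reflexive (rearrange m)) (+-monoˡ-≤ 2+2m (+-monoˡ-≤ 2 (≮⇒≥ y≮2+2m)))))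
        (<⇒≱ x<N)


module Toeplitz where

  open import Defs
  open import Data.Nat
  open import Data.Nat.Properties
  open import Data.Bool using (true; false; not)
  open import Data.Bool.Properties using (∨-zeroʳ)
  open import Data.Fin using (Fin; toℕ; fromℕ<)
  open import Data.Fin.Properties using (toℕ<n; toℕ-fromℕ<)
  open import Data.List using (List; _∷_; [])
  open import Data.Product using (Σ; _×_; _,_; proj₁; proj₂; ∃)
  open import Data.Sum using (_⊎_; inj₁; inj₂)
  open import Relation.Binary.PropositionalEquality
  open BoolReflection
  open Difference
  open Positions

  module Odd (m : ℕ) (1≤m : 1 ≤ m) where
    open Distance m
    open Edges m 1≤m

    n : ℕ
    n = 2 * p

    3≤n : 3 ≤ n
    3≤n = ≤-trans (s≤s (+-mono-≤ 1≤m 1≤m)) (m≤m+n p (p + 0))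

    S : List ℕ
    S = 2 ∷ p ∷ []

    n≡N : n ≡ N
    n≡N = cong (p +_) (+-identityʳ p)

    toℕ<N : (u : Fin n) → toℕ u < N
    toℕ<N u = subst (toℕ u <_) n≡N (toℕ<n u)

    vertex : ∀ y → y < N → Fin n
    vertex y y<N = fromℕ< (subst (y <_) (sym n≡N) y<N)

    toℕ-vertex : ∀ y y<N → toℕ (vertex y y<N) ≡ y
    toℕ-vertex y y<N = toℕ-fromℕ< _

    G : Fin n → Fin n → ℕ
    G u v = D ∣ toℕ u - toℕ v ∣

    adj⇒Step : ∀ (i j : Fin n) → adj S i j ≡ true → Step ∣ toℕ i - toℕ j ∣
    adj⇒Step i j e with ∨-true _ _ (proj₂ (∧-true _ _ e))
    ... | inj₁ is2 = inj₁ (≡ᵇ-true⇒≡ _ _ is2)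
    ... | inj₂ rest with ∨-true _ _ rest
    ...   | inj₁ isp = inj₂ (≡ᵇ-true⇒≡ _ _ isp)
    ...   | inj₂ ()

    Step⇒≢ : ∀ {a b} → Step ∣ a - b ∣ → a ≢ b
    Step⇒≢ {a} (inj₁ is2) refl = 0≢1+n (trans (sym (∣n-n∣≡0 a)) is2)
    Step⇒≢ {a} (inj₂ isp) refl = 0≢1+n (trans (sym (∣n-n∣≡0 a)) isp)

    Step⇒adj : ∀ (i j : Fin n) → Step ∣ toℕ i - toℕ j ∣ → adj S i j ≡ true
    Step⇒adj i j step rewrite ≢⇒≡ᵇ-false (toℕ i) (toℕ j) (Step⇒≢ step) with step
    ... | inj₁ is2 rewrite is2 = refl
    ... | inj₂ isp rewrite isp | ≡⇒≡ᵇ-true p p refl = ∨-zeroʳ _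

    ∣-∣<N : ∀ (u v : Fin n) → ∣ toℕ u - toℕ v ∣ < N
    ∣-∣<N u v = ≤-<-trans (∣m-n∣≤m⊔n (toℕ u) (toℕ v)) (⊔-lub (toℕ<N u) (toℕ<N v))

    G≡0⇒≡ : ∀ u v → G u v ≡ 0 → toℕ u ≡ toℕ v
    G≡0⇒≡ u v G≡0 = ∣m-n∣≡0⇒m≡n (D≡0⇒≡0 _ (∣-∣<N u v) G≡0)

    ≡⇒G≡0 : ∀ u v → toℕ u ≡ toℕ v → G u v ≡ 0
    ≡⇒G≡0 u v u≡v rewrite u≡v | ∣n-n∣≡0 (toℕ v) = refl

    G<n : ∀ u v → G u v < n
    G<n u v = subst (G u v <_) (sym n≡N) (D<2p _ (∣-∣<N u v))

    G-adj : ∀ u w v → adj S w v ≡ true → G u v ≤ suc (G u w)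
    G-adj u w v wv with ∣-∣≡⇒+≡ (toℕ w) (toℕ v) refl
    ... | inj₁ w+s≡v = subst (λ t → D ∣ toℕ u - t ∣ ≤ suc (G u w)) w+s≡v
          (proj₂ (D-near-along-edge (toℕ u) (toℕ w) (adj⇒Step w v wv) (toℕ<N u) (subst (_< N) (sym w+s≡v) (toℕ<N v))))
    ... | inj₂ v+s≡w = subst (λ t → G u v ≤ suc (D ∣ toℕ u - t ∣)) v+s≡w
          (proj₁ (D-near-along-edge (toℕ u) (toℕ v) (adj⇒Step w v wv) (toℕ<N u) (subst (_< N) (sym v+s≡w) (toℕ<N w))))

    G-pred : ∀ u v k → G u v ≡ suc k → ∃ λ w → adj S w v ≡ true × G u w ≡ k
    G-pred u v k G≡1+k with closer-neighbour (toℕ u) (toℕ v) (toℕ<N u) (toℕ<N v) (n≢0⇒n>0 ∣u-v∣≢0)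
      where
      ∣u-v∣≢0 : ∣ toℕ u - toℕ v ∣ ≢ 0
      ∣u-v∣≢0 ∣u-v∣≡0 = 0≢1+n (trans (sym (cong D ∣u-v∣≡0)) G≡1+k)
    ... | y , y<N , step , closer-by-1 =
      w , Step⇒adj w v (subst (λ t → Step ∣ t - toℕ v ∣) (sym (toℕ-vertex y y<N)) step) ,
      suc-injective (trans (cong (λ t → suc (D ∣ toℕ u - t ∣)) (toℕ-vertex y y<N)) (trans closer-by-1 G≡1+k))
      where
      w = vertex y y<N

    open ShortestPath.Characterisation n S G G≡0⇒≡ ≡⇒G≡0 G-adj G-pred G<n

    inR≡ : ∀ v w u → inR S v w u ≡ not (G u v ≡ᵇ G u w)
    inR≡ v w u rewrite dist≡G u v | dist≡G u w = refl

    inR-false⇒ : ∀ v w u → inR S v w u ≡ false → G u v ≡ G u w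
    inR-false⇒ v w u u∉R with G u v ≡ᵇ G u w in eq | inR≡ v w u
    ... | true  | _ = ≡ᵇ-true⇒≡ _ _ eq
    ... | false | u∈R with trans (sym u∈R) u∉R
    ...   | ()

    ⇒inR-false : ∀ v w u → G u v ≡ G u w → inR S v w u ≡ false
    ⇒inR-false v w u G≡G rewrite inR≡ v w u | ≡⇒≡ᵇ-true _ _ G≡G = refl

    unresolving-edge : ∀ u → Σ (Fin n) λ v → Σ (Fin n) λ w → adj S v w ≡ true × inR S v w u ≡ false
    unresolving-edge u with equidistant-edge (toℕ u) (toℕ<N u)
    ... | y , z , y<N , z<N , step , D≡D =
      vertex y y<N , vertex z z<N , Step⇒adj (vertex y y<N) (vertex z z<N) step′ , ⇒inR-false _ _ u G≡G
      where
      step′ : Step ∣ toℕ (vertex y y<N) - toℕ (vertex z z<N) ∣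
      step′ rewrite toℕ-vertex y y<N | toℕ-vertex z z<N = step
      G≡G : G u (vertex y y<N) ≡ G u (vertex z z<N)
      G≡G rewrite toℕ-vertex y y<N | toℕ-vertex z z<N = D≡D

    few-unresolved : ∀ (v w : Fin n) → adj S v w ≡ true →
      Σ ℕ λ c₁ → Σ ℕ λ c₂ → ∀ u → inR S v w u ≡ false → toℕ u ≡ c₁ ⊎ toℕ u ≡ c₂
    few-unresolved v w vw with ∣-∣≡⇒+≡ (toℕ v) (toℕ w) refl
    ... | inj₁ v+s≡w with at-most-two-equidistant (toℕ v) (adj⇒Step v w vw) (subst (_< N) (sym v+s≡w) (toℕ<N w))
    ...   | c₁ , c₂ , only = c₁ , c₂ , λ u u∉R →
      only (toℕ u) (toℕ<N u) (trans (inR-false⇒ v w u u∉R) (cong (λ t → D ∣ toℕ u - t ∣) (sym v+s≡w)))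
    few-unresolved v w vw | inj₂ w+s≡v
      with at-most-two-equidistant (toℕ w) (adj⇒Step v w vw) (subst (_< N) (sym w+s≡v) (toℕ<N v))
    ...   | c₁ , c₂ , only = c₁ , c₂ , λ u u∉R →
      only (toℕ u) (toℕ<N u) (trans (sym (inR-false⇒ v w u u∉R)) (cong (λ t → D ∣ toℕ u - t ∣) (sym w+s≡v)))


open import Defs
open import Data.Nat as ℕ using (ℕ; zero; suc; _*_; _∸_; s≤s; z≤n)
open import Data.Nat.Primality using (Prime; prime⇒irreducible; ¬prime[0]; ¬prime[1])
open import Data.Nat.Divisibility using (divides)
open import Data.Fin using (Fin; toℕ) renaming (zero to fz; suc to fs)
open import Data.List using (List; _∷_; [])
open import Data.Product using (Σ; _×_; _,_)
open import Data.Sum using (_⊎_; inj₁; inj₂)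
open import Data.Bool using (true; false)
open import Data.Integer using (+_)
open import Data.Rational.Unnormalised using (ℚᵘ; mkℚᵘ; _≤_)
open import Relation.Binary.PropositionalEquality using (_≡_; refl; sym; cong)
open import Relation.Nullary using (contradiction)
import Data.Nat.Properties as ℕP
open Difference using (evenOdd; even; odd)
open Fractional using (ldim-lower-bound; ldim-upper-bound)

LdimBounds : ℕ → Set
LdimBounds p =
  ((ζ : Fin (2 * p) → ℚᵘ) → LocalResolving (2 * p) (2 ∷ p ∷ []) ζ →
    mkℚᵘ (+ (2 * p)) (2 * p ∸ 2) ≤ sumFin ζ)
  × Σ (Fin (2 * p) → ℚᵘ) (λ ζ → LocalResolving (2 * p) (2 ∷ p ∷ []) ζ
    × (sumFin ζ ≤ mkℚᵘ (+ (2 * p)) (2 * p ∸ 3)))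

ldim-bounds-odd : ∀ m → 1 ℕ.≤ m → LdimBounds (suc (m ℕ.+ m))
ldim-bounds-odd m 1≤m =
  (λ ζ resolving → ldim-lower-bound n S ζ (ℕP.≤-trans (s≤s (s≤s z≤n)) 3≤n) resolving unresolving-edge) ,
  ldim-upper-bound n S 3≤n few-unresolved
  where
  open Toeplitz.Odd m 1≤m

-- With labels shifted by one the edges are {0,2} and {1,3}; both facts are
-- checked by evaluation.
ldim-bounds-2 : LdimBounds 2
ldim-bounds-2 =
  (λ ζ resolving → ldim-lower-bound 4 S ζ (s≤s (s≤s z≤n)) resolving unresolving-edge) ,
  ldim-upper-bound 4 S (s≤s (s≤s (s≤s z≤n))) few-unresolved
  where
  S : List ℕ
  S = 2 ∷ 2 ∷ []

  pattern 0′ = fz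
  pattern 1′ = fs fz
  pattern 2′ = fs (fs fz)
  pattern 3′ = fs (fs (fs fz))

  unresolving-edge : ∀ u → Σ (Fin 4) λ v → Σ (Fin 4) λ w → adj S v w ≡ true × inR S v w u ≡ false
  unresolving-edge 0′ = 1′ , 3′ , refl , refl
  unresolving-edge 1′ = 0′ , 2′ , refl , refl
  unresolving-edge 2′ = 1′ , 3′ , refl , refl
  unresolving-edge 3′ = 0′ , 2′ , refl , refl

  few-unresolved : ∀ (v w : Fin 4) → adj S v w ≡ true →
    Σ ℕ λ c₁ → Σ ℕ λ c₂ → ∀ u → inR S v w u ≡ false → toℕ u ≡ c₁ ⊎ toℕ u ≡ c₂
  few-unresolved 0′ 2′ _ = 1 , 3 , λ { 0′ () ; 1′ _ → inj₁ refl ; 2′ () ; 3′ _ → inj₂ refl }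
  few-unresolved 2′ 0′ _ = 1 , 3 , λ { 0′ () ; 1′ _ → inj₁ refl ; 2′ () ; 3′ _ → inj₂ refl }
  few-unresolved 1′ 3′ _ = 0 , 2 , λ { 0′ _ → inj₁ refl ; 1′ () ; 2′ _ → inj₂ refl ; 3′ () }
  few-unresolved 3′ 1′ _ = 0 , 2 , λ { 0′ _ → inj₁ refl ; 1′ () ; 2′ _ → inj₂ refl ; 3′ () }
  few-unresolved 0′ 0′ ()
  few-unresolved 0′ 1′ ()
  few-unresolved 0′ 3′ ()
  few-unresolved 1′ 0′ ()
  few-unresolved 1′ 1′ ()
  few-unresolved 1′ 2′ ()
  few-unresolved 2′ 1′ ()
  few-unresolved 2′ 2′ ()
  few-unresolved 2′ 3′ ()
  few-unresolved 3′ 0′ ()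
  few-unresolved 3′ 2′ ()
  few-unresolved 3′ 3′ ()

prime⇒2⊎odd : ∀ p → Prime p → p ≡ 2 ⊎ Σ ℕ (λ m → p ≡ suc (m ℕ.+ m) × 1 ℕ.≤ m)
prime⇒2⊎odd p p-prime with evenOdd p
... | even zero          = contradiction p-prime ¬prime[0]
... | even (suc zero)    = inj₁ refl
... | even (suc (suc a)) with prime⇒irreducible p-prime (divides 2 (cong (suc (suc a) ℕ.+_) (sym (ℕP.+-identityʳ _))))
...   | inj₁ ()
...   | inj₂ 2+a≡2[2+a] = contradiction (sym 2+a≡2[2+a]) (ℕP.m+1+n≢m (suc (suc a)))
prime⇒2⊎odd p p-prime | odd zero    = contradiction p-prime ¬prime[1]
prime⇒2⊎odd p p-prime | odd (suc a) = inj₂ (suc a , refl , s≤s z≤n)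

theorem5 : (p : ℕ) → Prime p →
    ((ζ : Fin (2 * p) → ℚᵘ) → LocalResolving (2 * p) (2 ∷ p ∷ []) ζ →
      mkℚᵘ (+ (2 * p)) (2 * p ∸ 2) ≤ sumFin ζ)
    × Σ (Fin (2 * p) → ℚᵘ) (λ ζ → LocalResolving (2 * p) (2 ∷ p ∷ []) ζ
      × (sumFin ζ ≤ mkℚᵘ (+ (2 * p)) (2 * p ∸ 3)))
theorem5 p p-prime with prime⇒2⊎odd p p-prime
... | inj₁ refl              = ldim-bounds-2
... | inj₂ (m , refl , 1≤m) = ldim-bounds-odd m 1≤m
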